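{- In the type theory described in the context, define $\wedge^{\mathsf{M}}:\mathsf{M}\,\mathsf{Prop}\to\mathsf{Prop}$ by $\wedge^{\mathsf{M}}x :\equiv (x=\mathsf{unit}^{\mathsf{M}}_{\mathsf{Prop}}\,\mathsf{True})$ and $\vee^{\mathsf{M}}:\mathsf{M}\,\mathsf{Prop}\to\mathsf{Prop}$ by $\vee^{\mathsf{M}}x:\equiv\neg(x=\mathsf{unit}^{\mathsf{M}}_{\mathsf{Prop}}\,\mathsf{False})$. Then both are retractions of $\mathsf{unit}^{\mathsf{M}}_{\mathsf{Prop}}$: for every $P:\mathsf{Prop}$, $\wedge^{\mathsf{M}}(\mathsf{unit}^{\mathsf{M}}_{\mathsf{Prop}}P)=P$ and $\vee^{\mathsf{M}}(\mathsf{unit}^{\mathsf{M}}_{\mathsf{Prop}}P)=P$.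
   Context: Work in an extensional dependent type theory with a universe $\mathsf{Type}$ and a universe $\mathsf{Prop}$ of classical propositions (closed under $\to,\times,\Pi$, with classical $\lor,\exists$; identity types in $\mathsf{Prop}$), assuming excluded middle for $\mathsf{Prop}$, propositional extensionality $(P\leftrightarrow Q)\to P=Q$, and functional extensionality. Nondeterminism: a type former $\mathsf{M}:\mathsf{Type}\to\mathsf{Type}$ with $\mathsf{unit}^{\mathsf{M}}$, $\mathsf{mult}^{\mathsf{M}}$, $\mathsf{lift}^{\mathsf{M}}$ satisfying the monad laws. Let $\mathsf{P}_+X:=\Sigma(S:X\to\mathsf{Prop}).\,\exists x.\,S\,x$ be the classical nonempty-powerset monad with unit $x\mapsto(\lambda y.\,x=y)$, lift sending $S$ to $\lambda y.\,\exists z.\,y=f\,z\wedge S\,z$, and multiplication by union. Assume a natural transformation $\mathsf{picture}_X:\mathsf{M}X\to\mathsf{P}_+X$ which is injective for every $X$, commutes with units ($\mathsf{picture}_X\circ\mathsf{unit}^{\mathsf{M}}_X=\mathsf{unit}^{\mathsf{P}_+}_X$) and multiplications, and such that $\mathsf{lift}^{\mathsf{P}_+}\mathsf{picture}_X$ is an equivalence; write $\mathsf{pic}_X\,x\,y:=\pi_1(\mathsf{picture}_X\,x)\,y$. Also assume a term of type $\prod_{x:\mathsf{M}X}\mathsf{M}(\Sigma y:X.\,\mathsf{pic}_X\,x\,y)$, and that whenever $X$ is a subsingleton, $\mathsf{unit}^{\mathsf{M}}_X:X\to\mathsf{M}X$ is an equivalence. -}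

module Defs where

open import Level using (0ℓ)
open import Data.Unit using (⊤; tt)
open import Data.Empty using (⊥)
open import Data.Product using (Σ; _×_; _,_; proj₁; proj₂)
open import Data.Sum using (_⊎_)
open import Function using (_∘_; id)
open import Relation.Nullary using (¬_)
open import Relation.Binary.PropositionalEquality using (_≡_; refl)
open import Axiom.Extensionality.Propositional using (Extensionality)
open import Axiom.UniquenessOfIdentityProofs.WithK using (uip)

isProp : Set → Set
isProp A = (a b : A) → a ≡ b

-- f is an equivalence (types are sets: quasi-inverse).
IsEquiv : {A B : Set} → (A → B) → Set
IsEquiv {A} {B} f = Σ (B → A) λ g → ((a : A) → g (f a) ≡ a) × ((b : B) → f (g b) ≡ b)

-- The universe  Type  is Agda's  Set
-- (extensional: K/UIP holds).  The universe  Prop  of classical propositions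
-- is an (impredicative) type  Prop : Set  of codes, each decoding via  El
-- to a subsingleton; it is closed under all propositional type formers
-- (every subsingleton of Type has a code), satisfies propositional
-- extensionality and excluded middle.
record Logic : Set₁ where
  field
    funext    : Extensionality 0ℓ 0ℓ
    Prop      : Set
    El        : Prop → Set
    El-isProp : (P : Prop) → isProp (El P)
    ⌜_⌝       : (A : Set) → isProp A → Prop
    El-in     : (A : Set) (p : isProp A) → A → El (⌜ A ⌝ p)
    El-out    : (A : Set) (p : isProp A) → El (⌜ A ⌝ p) → A
    propext   : (P Q : Prop) → (El P → El Q) → (El Q → El P) → P ≡ Q
    lem       : (P : Prop) → El P ⊎ ¬ El P

module LogicOps (L : Logic) where
  open Logic L public

  ¬-isProp : (A : Set) → isProp (¬ A)
  ¬-isProp A f g = funext (λ a → ⊥-prop (f a) (g a))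
    where
    ⊥-prop : (x y : ⊥) → x ≡ y
    ⊥-prop ()

  ≡-isProp : {X : Set} (x y : X) → isProp (x ≡ y)
  ≡-isProp x y = uip

  True : Prop
  True = ⌜ ⊤ ⌝ (λ { tt tt → refl })

  False : Prop
  False = ⌜ ⊥ ⌝ (λ ())

  Eqₚ : {X : Set} → X → X → Prop
  Eqₚ x y = ⌜ x ≡ y ⌝ (≡-isProp x y)

  Notₚ : Set → Prop
  Notₚ A = ⌜ ¬ A ⌝ (¬-isProp A)

  Exₚ : (X : Set) → (X → Set) → Prop
  Exₚ X S = ⌜ ¬ ¬ Σ X S ⌝ (¬-isProp (¬ Σ X S))

  ex-intro : {X : Set} {S : X → Set} (x : X) → S x → El (Exₚ X S)
  ex-intro {X} {S} x s = El-in _ _ (λ k → k (x , s))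

  ex-elim : {X : Set} {S : X → Set} {Q : Prop} →
            El (Exₚ X S) → ((x : X) → S x → El Q) → El Q
  ex-elim {X} {S} {Q} e h with lem Q
  ... | Data.Sum.inj₁ q = q
  ... | Data.Sum.inj₂ nq =
    Data.Empty.⊥-elim (El-out _ _ e (λ { (x , s) → nq (h x s) }))

  P₊ : Set → Set
  P₊ X = Σ (X → Prop) λ S → El (Exₚ X (El ∘ S))

  unitP : {X : Set} → X → P₊ X
  unitP x = (λ y → Eqₚ x y) , ex-intro x (El-in _ _ refl)

  liftP : {X Y : Set} → (X → Y) → P₊ X → P₊ Y
  liftP {X} {Y} f (S , e) =
    (λ y → Exₚ X (λ z → (y ≡ f z) × El (S z))) ,
    ex-elim {Q = Exₚ Y _} e (λ z s → ex-intro (f z) (ex-intro z (refl , s)))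

  multP : {X : Set} → P₊ (P₊ X) → P₊ X
  multP {X} (𝒮 , e) =
    (λ x → Exₚ (P₊ X) (λ T → El (𝒮 T) × El (proj₁ T x))) ,
    ex-elim {Q = Exₚ X _} e
      (λ T t → ex-elim {Q = Exₚ X _} (proj₂ T)
        (λ x s → ex-intro x (ex-intro T (t , s))))

record Nondet (L : Logic) : Set₁ where
  open LogicOps L
  field
    M     : Set → Set
    unitM : {X : Set} → X → M X
    multM : {X : Set} → M (M X) → M X
    liftM : {X Y : Set} → (X → Y) → M X → M Y
    liftM-id   : {X : Set} (x : M X) → liftM id x ≡ x
    liftM-comp : {X Y Z : Set} (g : Y → Z) (f : X → Y) (x : M X) →
                 liftM (g ∘ f) x ≡ liftM g (liftM f x)
    unitM-nat : {X Y : Set} (f : X → Y) (x : X) → liftM f (unitM x) ≡ unitM (f x)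
    multM-nat : {X Y : Set} (f : X → Y) (x : M (M X)) →
                liftM f (multM x) ≡ multM (liftM (liftM f) x)
    mult-unit  : {X : Set} (x : M X) → multM (unitM x) ≡ x
    mult-lunit : {X : Set} (x : M X) → multM (liftM unitM x) ≡ x
    mult-assoc : {X : Set} (x : M (M (M X))) →
                 multM (multM x) ≡ multM (liftM multM x)
    picture      : {X : Set} → M X → P₊ X
    picture-nat  : {X Y : Set} (f : X → Y) (x : M X) →
                   picture (liftM f x) ≡ liftP f (picture x)
    picture-inj  : {X : Set} (x y : M X) → picture x ≡ picture y → x ≡ y
    picture-unit : {X : Set} (x : X) → picture (unitM x) ≡ unitP x
    picture-mult : {X : Set} (x : M (M X)) →
                   picture (multM x) ≡ multP (liftP picture (picture x))
    liftP-picture-equiv : {X : Set} → IsEquiv (liftP (picture {X}))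
    select : {X : Set} (x : M X) → M (Σ X λ y → El (proj₁ (picture x) y))
    unit-subsingleton-equiv : {X : Set} → isProp X → IsEquiv (unitM {X})

  pic : {X : Set} → M X → X → Prop
  pic x y = proj₁ (picture x) y

module _ {L : Logic} (N : Nondet L) where
  open LogicOps L
  open Nondet N

  ∧ᴹ : M Prop → Prop
  ∧ᴹ x = Eqₚ x (unitM True)

  ∨ᴹ : M Prop → Prop
  ∨ᴹ x = Notₚ (x ≡ unitM False)

{-# OPTIONS --safe #-}
module Submission where

open import Defs
open import Data.Product using (_×_; _,_; proj₁)
open import Data.Unit using (tt)
open import Data.Empty using (⊥-elim)
open import Data.Sum using (inj₁; inj₂)
open import Relation.Nullary using (¬_)
open import Relation.Binary.PropositionalEquality
  using (_≡_; refl; cong; cong-app; subst; sym; trans)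

-- Since picture sends unitᴹ x to the singleton {x}, unitᴹ is injective; so
-- unitᴹ P = unitᴹ True holds iff P = True, and unitᴹ P = unitᴹ False iff
-- P = False.  Propositional extensionality identifies P = True with P itself,
-- and, classically, ¬ (P = False) with P as well.

module PropLemmas (L : Logic) where
  open LogicOps L

  unitP-injective : {X : Set} (x y : X) → unitP x ≡ unitP y → x ≡ y
  unitP-injective x y e = El-out _ _ (subst El (sym x≡y-is-y≡y) (El-in _ _ refl))
    where
    x≡y-is-y≡y : Eqₚ x y ≡ Eqₚ y y
    x≡y-is-y≡y = cong-app (cong proj₁ e) y

  El⇒≡True : (P : Prop) → El P → P ≡ True
  El⇒≡True P p = propext P True (λ _ → El-in _ _ tt) (λ _ → p)

  ≡True⇒El : (P : Prop) → P ≡ True → El P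
  ≡True⇒El P P≡True = subst El (sym P≡True) (El-in _ _ tt)

  ¬El⇒≡False : (P : Prop) → ¬ El P → P ≡ False
  ¬El⇒≡False P ¬p = propext P False (λ p → ⊥-elim (¬p p)) (λ f → ⊥-elim (El-out _ _ f))

  El⇒≢False : (P : Prop) → El P → ¬ P ≡ False
  El⇒≢False P p P≡False = El-out _ _ (subst El P≡False p)

module _ {L : Logic} (N : Nondet L) where
  open LogicOps L
  open PropLemmas L
  open Nondet N

  unitM-injective : {X : Set} (x y : X) → unitM x ≡ unitM y → x ≡ y
  unitM-injective x y e = unitP-injective x y
    (trans (sym (picture-unit x)) (trans (cong picture e) (picture-unit y)))

  ∧ᴹ-unitM : (P : Prop) → ∧ᴹ N (unitM P) ≡ P
  ∧ᴹ-unitM P = propext _ P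
    (λ u → ≡True⇒El P (unitM-injective P True (El-out _ _ u)))
    (λ p → El-in _ _ (cong unitM (El⇒≡True P p)))

  ∨ᴹ-unitM : (P : Prop) → ∨ᴹ N (unitM P) ≡ P
  ∨ᴹ-unitM P = propext _ P from-∨ᴹ
    (λ p → El-in _ _ (λ u → El⇒≢False P p (unitM-injective P False u)))
    where
    from-∨ᴹ : El (∨ᴹ N (unitM P)) → El P
    from-∨ᴹ u with lem P
    ... | inj₁ p  = p
    ... | inj₂ ¬p = ⊥-elim (El-out _ _ u (cong unitM (¬El⇒≡False P ¬p)))

mainTheorem2 : (L : Logic) (N : Nondet L) (P : Logic.Prop L) →
    (∧ᴹ N (Nondet.unitM N P) ≡ P) × (∨ᴹ N (Nondet.unitM N P) ≡ P)
mainTheorem2 L N P = ∧ᴹ-unitM N P , ∨ᴹ-unitM N P
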